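{- There is an algorithm which, given: - a finite set $C$ of colours, - a Wang tileset $T\subseteq C^{\{S,E,N,W\}}$ for the half-plane $\mathbb H=\{(m,n)\in\mathbb Z^2: m\ge n\}$, - a seed tile $t_0\in T$, constructs a finite set $\Pi_T$ of Wang tiles on $L$ and a tile $\pi_0\in\Pi_T$, such that there exists a valid tiling of $\mathbb H$ by $T$ with value $t_0$ at $(0,0)$ if and only if there exists a valid tiling of $L$ by $\Pi_T$ with value $\pi_0$ at the identity $1\in L$.
   Context: **The group.** $L$ is the lamplighter group $\mathbb Z/2\wr\mathbb Z$, with generators $a,b$ and presentation $\langle a,b\mid (a^nb^{ -n})^2\ (n\ge1)\rangle$. **Wang tiles on $L$.** A Wang tileset on $L$ is a finite set $\Pi\subseteq D^{\{a,b,a^{ -1},b^{ -1}\}}$ for some finite colour set $D$. A tiling $\eta\colon L\to\Pi$ is valid if $\eta_g(a)=\eta_{ga}(a^{ -1})$ and $\eta_g(b)=\eta_{gb}(b^{ -1})$ for all $g\in L$. **Wang tiles on $\mathbb H$.** A tile $(i,j,k,\ell)\in T$ has colours $i,j,k,\ell$ on its south, east, north and west sides. A tiling $\zeta\colon\mathbb H\to T$ is valid if, for all $(m,n)\in\mathbb H$, the north colour of $\zeta_{(m,n-1)}$ equals the south colour of $\zeta_{(m,n)}$, and the east colour of $\zeta_{(m,n)}$ equals the west colour of $\zeta_{(m+1,n)}$. -}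

module Defs where

open import Data.Bool using (Bool; true; false; not; if_then_else_)
open import Data.Maybe using (Maybe; just; nothing)
open import Data.Nat using (ℕ; zero; suc)
open import Data.Integer using (ℤ; +_; -[1+_]; _+_; _-_; _≤_; 0ℤ; 1ℤ)
open import Data.Fin using (Fin)
open import Data.Product using (_×_; _,_; Σ; ∃)
open import Data.List using (List)
open import Data.List.Membership.Propositional using (_∈_)
open import Relation.Binary.PropositionalEquality using (_≡_)
open import Function.Bundles using (_⇔_)

-- A finitely supported lamp configuration on ℕ is a finite bit string
-- with no trailing 'false': either empty ('nothing') or a nonempty
-- string ending in 'true' ('just x', x : NE).  This is a canonical
-- representation, so propositional equality is equality in the group.

data NE : Set where
  end : NE                 -- the string [true]
  _∷_ : Bool → NE → NE

NList : Set
NList = Maybe NE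

single : ℕ → NE
single zero    = end
single (suc n) = false ∷ single n

consN : Bool → NList → NList
consN true  nothing  = just end
consN false nothing  = nothing
consN b     (just y) = just (b ∷ y)

toggleNE : ℕ → NE → NList
toggleNE zero    end     = nothing
toggleNE (suc n) end     = just (true ∷ single n)
toggleNE zero    (b ∷ x) = just (not b ∷ x)
toggleNE (suc n) (b ∷ x) = consN b (toggleNE n x)

toggleN : ℕ → NList → NList
toggleN n nothing  = just (single n)
toggleN n (just x) = toggleNE n x

-- finitely supported configurations ℤ → Z/2:
-- (lamps at 0,1,2,… ; lamps at -1,-2,-3,…)
Lamps : Set
Lamps = NList × NList

toggle : ℤ → Lamps → Lamps
toggle (+ n)     (p , q) = (toggleN n p , q)
toggle -[1+ n ]  (p , q) = (p , toggleN n q)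

-- An element of L = (⊕_ℤ Z/2) ⋊ ℤ : (lamp configuration , lamplighter position),
-- with product (f , m)(g , n) = (f + σ^m g , m + n).
L : Set
L = Lamps × ℤ

one : L
one = ((nothing , nothing) , 0ℤ)

-- Generators a = t = (0 , 1) and b = δ₀ t = (e₀ , 1); these satisfy the
-- presentation ⟨a,b | (aⁿb⁻ⁿ)² (n ≥ 1)⟩.  Right multiplication:
_·a : L → L
(f , m) ·a = (f , m + 1ℤ)

_·b : L → L
(f , m) ·b = (toggle m f , m + 1ℤ)

record LTile (d : ℕ) : Set where
  constructor ltile
  field
    col-a    : Fin d
    col-b    : Fin d
    col-a⁻¹  : Fin d
    col-b⁻¹  : Fin d
open LTile public

ValidL : {d : ℕ} → List (LTile d) → (L → LTile d) → Set
ValidL Π η =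
  (∀ g → η g ∈ Π) ×
  (∀ g → col-a (η g) ≡ col-a⁻¹ (η (g ·a))) ×
  (∀ g → col-b (η g) ≡ col-b⁻¹ (η (g ·b)))

TilesL : {d : ℕ} → List (LTile d) → LTile d → Set
TilesL Π π₀ = Σ (L → LTile _) λ η → ValidL Π η × (η one ≡ π₀)

record HTile (c : ℕ) : Set where
  constructor htile
  field
    south : Fin c
    east  : Fin c
    north : Fin c
    west  : Fin c
open HTile public

-- A tiling of ℍ is given as a map ζ : ℤ → ℤ → HTile c of which only the
-- values at points (m , n) with n ≤ m matter (all constraints below are
-- imposed only on ℍ; note (m , n-1) and (m+1 , n) lie in ℍ if (m , n) does).
ValidH : {c : ℕ} → List (HTile c) → (ℤ → ℤ → HTile c) → Set
ValidH T ζ =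
  (∀ m n → n ≤ m → ζ m n ∈ T) ×
  (∀ m n → n ≤ m → north (ζ m (n - 1ℤ)) ≡ south (ζ m n)) ×
  (∀ m n → n ≤ m → east (ζ m n) ≡ west (ζ (m + 1ℤ) n))

TilesH : {c : ℕ} → List (HTile c) → HTile c → Set
TilesH T t₀ = Σ (ℤ → ℤ → HTile _) λ ζ → ValidH T ζ × (ζ 0ℤ 0ℤ ≡ t₀)

-- An "algorithm" = an Agda function (every Agda function is computable).
Reduction : Set
Reduction = (c : ℕ) → List (HTile c) → HTile c → Σ ℕ λ d → List (LTile d) × LTile d

-- Look at L from the lamplighter: an element is the sequence of lamps ahead of
-- it, the sequence behind it, and its position p.  The elements with 1ʸ ahead
-- and 1ˣ behind form a sheet; a moves (y + 1, x, p) to (y, x + 1, p + 1), so the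
-- sheet is a union of a-chains (k, 0, n) → … → (0, k, n + k), one for each tile
-- of ℍ, at row n and offset k from the diagonal.  The b-edge from the first
-- point of a chain reaches the first point of the chain of the tile above, and
-- the one from the last point reaches the last point of the chain of the tile
-- to its right.  A tiling of ℍ therefore becomes a tiling of L: the first points
-- show the north and south colours, the last points the east and west colours,
-- a carry colour passes the tile along its chain, the diagonal chain and the
-- a-rays leaving the last points have their own a-colours, and everything else
-- is blank.  Conversely, starting from the seed, the colours force diagonal
-- tiles along the diagonal chain, first tiles at x = 0 and last tiles at y = 0,
-- and a carry cannot end early, since the ray after a last tile would run into
-- the last point at the end of its chain; so every chain carries one tile of T,
-- and these tile ℍ.

module Submission where

open import Defs
open import Data.Nat using (ℕ)
open import Data.Product using (Σ; _×_; proj₁; proj₂)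
open import Data.List using (List)
open import Data.List.Membership.Propositional using (_∈_)
open import Function.Bundles using (_⇔_)

open import Data.Bool using (Bool; true; false; not)
open import Data.Fin using (Fin)
open import Data.Integer using (ℤ; +_; -[1+_]; 0ℤ; 1ℤ; _+_; _-_; _≤_; ∣_∣)
import Data.Integer.Properties as ℤP
open import Data.Integer.Tactic.RingSolver using (solve-∀)
open import Data.List using (_∷_; _++_; map; length; lookup; allFin)
open import Data.List.Membership.Propositional.Properties
  using (∈-map⁺; ∈-map⁻; ∈-++⁺ˡ; ∈-++⁺ʳ; ∈-lookup; ∈-allFin)
import Data.List.Relation.Unary.All as All
open import Data.List.Relation.Unary.All.Properties using (map⁺; ++⁺)
import Data.List.Relation.Unary.Any as Any
open import Data.List.Relation.Unary.Any using (here; there)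
open import Data.List.Relation.Unary.Any.Properties using (lookup-index)
open import Data.Maybe using (just; nothing)
import Data.Nat as ℕ
open import Data.Nat using (zero; suc)
import Data.Nat.Properties as ℕP
open import Data.Nat.GeneralisedArithmetic using (iterate)
open import Data.Product using (∃; _,_)
open import Data.Sum using (_⊎_; inj₁; inj₂)
open import Data.Unit using (⊤; tt)
open import Function.Base using (_∘_)
open import Function.Bundles using (mk⇔)
open import Relation.Binary.PropositionalEquality
open ≡-Reasoning

i+1-[1+j]≡i-j : ∀ i j → (i + 1ℤ) - (1ℤ + j) ≡ i - j
i+1-[1+j]≡i-j = solve-∀

i-0+1≡i+1-0 : ∀ i → (i - 0ℤ) + 1ℤ ≡ (i + 1ℤ) - 0ℤ
i-0+1≡i+1-0 = solve-∀

i+1+j≡i+[1+j] : ∀ i j → (i + 1ℤ) + j ≡ i + (1ℤ + j)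
i+1+j≡i+[1+j] = solve-∀

i+j+1≡i+[1+j] : ∀ i j → (i + j) + 1ℤ ≡ i + (1ℤ + j)
i+j+1≡i+[1+j] = solve-∀

i+1-1≡i : ∀ i → (i + 1ℤ) - 1ℤ ≡ i
i+1-1≡i = solve-∀

i-1+1≡i : ∀ i → (i - 1ℤ) + 1ℤ ≡ i
i-1+1≡i = solve-∀

i-[j-1]≡1+[i-j] : ∀ i j → i - (j - 1ℤ) ≡ 1ℤ + (i - j)
i-[j-1]≡1+[i-j] = solve-∀

i+1-j≡1+[i-j] : ∀ i j → (i + 1ℤ) - j ≡ 1ℤ + (i - j)
i+1-j≡1+[i-j] = solve-∀

∣1+i∣≡1+∣i∣ : ∀ {i} → 0ℤ ≤ i → ∣ 1ℤ + i ∣ ≡ suc ∣ i ∣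
∣1+i∣≡1+∣i∣ {+ _} _ = refl

ℤ-induction : (P : ℤ → Set) → P 0ℤ →
              (∀ i → P i → P (i + 1ℤ)) → (∀ i → P (i + 1ℤ) → P i) → ∀ i → P i
ℤ-induction P base up down (+ zero)     = base
ℤ-induction P base up down (+ suc n)    =
  subst P (cong +_ (ℕP.+-comm n 1)) (up (+ n) (ℤ-induction P base up down (+ n)))
ℤ-induction P base up down -[1+ zero ]  = down -[1+ zero ] base
ℤ-induction P base up down -[1+ suc n ] = down -[1+ suc n ] (ℤ-induction P base up down -[1+ n ])

iterate-commute : ∀ {A : Set} (f : A → A) x n → iterate f (f x) n ≡ f (iterate f x n)
iterate-commute f x zero    = refl
iterate-commute f x (suc n) = iterate-commute f (f x) n

iterate-inverse : ∀ {A : Set} {f g : A → A} → (∀ x → g (f x) ≡ x) →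
                  ∀ n x → iterate g (iterate f x n) n ≡ x
iterate-inverse inv zero    x = refl
iterate-inverse {f = f} {g} inv (suc n) x = begin
  iterate g (g (iterate f (f x) n)) n  ≡⟨ cong (λ y → iterate g (g y) n) (iterate-commute f x n) ⟩
  iterate g (g (f (iterate f x n))) n  ≡⟨ cong (λ y → iterate g y n) (inv _) ⟩
  iterate g (iterate f x n) n          ≡⟨ iterate-inverse inv n x ⟩
  x                                    ∎

hd : NList → Bool
hd nothing         = false
hd (just end)      = true
hd (just (b ∷ _))  = b

tl : NList → NList
tl nothing         = nothing
tl (just end)      = nothing
tl (just (_ ∷ x))  = just x

hd-consN : ∀ b l → hd (consN b l) ≡ b
hd-consN true  nothing  = refl
hd-consN false nothing  = refl
hd-consN true  (just _) = refl
hd-consN false (just _) = refl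

tl-consN : ∀ b l → tl (consN b l) ≡ l
tl-consN true  nothing  = refl
tl-consN false nothing  = refl
tl-consN true  (just _) = refl
tl-consN false (just _) = refl

consN-hd-tl : ∀ l → consN (hd l) (tl l) ≡ l
consN-hd-tl nothing            = refl
consN-hd-tl (just end)         = refl
consN-hd-tl (just (true ∷ _))  = refl
consN-hd-tl (just (false ∷ _)) = refl

toggleN-zero : ∀ l → toggleN 0 l ≡ consN (not (hd l)) (tl l)
toggleN-zero nothing            = refl
toggleN-zero (just end)         = refl
toggleN-zero (just (true ∷ _))  = refl
toggleN-zero (just (false ∷ _)) = refl

toggleN-suc : ∀ n l → toggleN (suc n) l ≡ consN (hd l) (toggleN n (tl l))
toggleN-suc n nothing         = refl
toggleN-suc n (just end)      = refl
toggleN-suc n (just (_ ∷ _))  = refl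

ones : ℕ → NList
ones zero    = nothing
ones (suc n) = consN true (ones n)

-- The lamplighter group seen from the lamplighter

-- A centred configuration lists the lamps at and ahead of the lamplighter,
-- then the lamps behind it, both read away from the lamplighter.
Centred : Set
Centred = Lamps × ℤ

stepA unstepA stepB : Lamps → Lamps
stepA   (r , l) = (tl r , consN (hd r) l)
unstepA (r , l) = (consN (hd l) r , tl l)
stepB   (r , l) = (tl r , consN (not (hd r)) l)

moveA moveB : Centred → Centred
moveA (f , p) = (stepA f , p + 1ℤ)
moveB (f , p) = (stepB f , p + 1ℤ)

stepA-consN : ∀ b r l → stepA (consN b r , l) ≡ (r , consN b l)
stepA-consN b r l = cong₂ (λ r′ b′ → (r′ , consN b′ l)) (tl-consN b r) (hd-consN b r)

stepB-consN : ∀ b r l → stepB (consN b r , l) ≡ (r , consN (not b) l)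
stepB-consN b r l = cong₂ (λ r′ b′ → (r′ , consN (not b′) l)) (tl-consN b r) (hd-consN b r)

unstepA-consN : ∀ b r l → unstepA (r , consN b l) ≡ (consN b r , l)
unstepA-consN b r l = cong₂ (λ b′ l′ → (consN b′ r , l′)) (hd-consN b l) (tl-consN b l)

stepA-unstepA : ∀ f → stepA (unstepA f) ≡ f
stepA-unstepA (r , l) = trans (stepA-consN (hd l) r (tl l)) (cong (r ,_) (consN-hd-tl l))

unstepA-stepA : ∀ f → unstepA (stepA f) ≡ f
unstepA-stepA (r , l) = trans (unstepA-consN (hd r) (tl r) l) (cong (_, l) (consN-hd-tl r))

stepB≡stepA∘toggle : ∀ f → stepB f ≡ stepA (toggle 0ℤ f)
stepB≡stepA∘toggle (r , l) =
  sym (trans (cong (λ r′ → stepA (r′ , l)) (toggleN-zero r)) (stepA-consN _ (tl r) l))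

centre uncentre : ℤ → Lamps → Lamps
centre   (+ n)     f = iterate stepA f n
centre   -[1+ n ]  f = iterate unstepA f (suc n)
uncentre (+ n)     f = iterate unstepA f n
uncentre -[1+ n ]  f = iterate stepA f (suc n)

uncentre-centre : ∀ j f → uncentre j (centre j f) ≡ f
uncentre-centre (+ n)    = iterate-inverse unstepA-stepA n
uncentre-centre -[1+ n ] = iterate-inverse stepA-unstepA (suc n)

centre-uncentre : ∀ j f → centre j (uncentre j f) ≡ f
centre-uncentre (+ n)    = iterate-inverse stepA-unstepA n
centre-uncentre -[1+ n ] = iterate-inverse unstepA-stepA (suc n)

centre-suc : ∀ j f → centre (j + 1ℤ) f ≡ stepA (centre j f)
centre-suc (+ n) f =
  trans (cong (iterate stepA f) (ℕP.+-comm n 1)) (iterate-commute stepA f n)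
centre-suc -[1+ zero ] f = sym (stepA-unstepA f)
centre-suc -[1+ suc n ] f =
  sym (trans (cong stepA (iterate-commute unstepA f (suc n))) (stepA-unstepA _))

centre-toggle : ∀ j f → centre j (toggle j f) ≡ toggle 0ℤ (centre j f)
centre-toggle (+ n)    (r , l) = ahead n r l
  where
  ahead : ∀ n r l → iterate stepA (toggleN n r , l) n ≡ toggle 0ℤ (iterate stepA (r , l) n)
  ahead zero    r l = refl
  ahead (suc n) r l =
    trans (cong (λ f → iterate stepA f n)
                (trans (cong (λ r′ → stepA (r′ , l)) (toggleN-suc n r)) (stepA-consN _ _ l)))
          (ahead n (tl r) (consN (hd r) l))
centre-toggle -[1+ n ] (r , l) = behind n r l
  where
  behind : ∀ n r l →
           iterate unstepA (r , toggleN n l) (suc n) ≡ toggle 0ℤ (iterate unstepA (r , l) (suc n))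
  behind zero r l
    rewrite toggleN-zero l | toggleN-zero (consN (hd l) r) | hd-consN (hd l) r | tl-consN (hd l) r =
    unstepA-consN _ r (tl l)
  behind (suc n) r l =
    trans (cong (λ f → iterate unstepA f (suc n))
                (trans (cong (λ l′ → unstepA (r , l′)) (toggleN-suc n l)) (unstepA-consN _ r _)))
          (behind n (consN (hd l) r) (tl l))

toCentred fromCentred : L → Centred
toCentred   (f , j) = (centre j f , j)
fromCentred (f , j) = (uncentre j f , j)

fromCentred-toCentred : ∀ g → fromCentred (toCentred g) ≡ g
fromCentred-toCentred (f , j) = cong (_, j) (uncentre-centre j f)

toCentred-fromCentred : ∀ w → toCentred (fromCentred w) ≡ w
toCentred-fromCentred (f , j) = cong (_, j) (centre-uncentre j f)

toCentred-·a : ∀ g → toCentred (g ·a) ≡ moveA (toCentred g)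
toCentred-·a (f , j) = cong (_, j + 1ℤ) (centre-suc j f)

toCentred-·b : ∀ g → toCentred (g ·b) ≡ moveB (toCentred g)
toCentred-·b (f , j) = cong (_, j + 1ℤ) (begin
  centre (j + 1ℤ) (toggle j f)     ≡⟨ centre-suc j (toggle j f) ⟩
  stepA (centre j (toggle j f))    ≡⟨ cong stepA (centre-toggle j f) ⟩
  stepA (toggle 0ℤ (centre j f))   ≡⟨ stepB≡stepA∘toggle (centre j f) ⟨
  stepB (centre j f)               ∎)

fromCentred-intertwines : ∀ {f : L → L} {g : Centred → Centred} →
  (∀ x → toCentred (f x) ≡ g (toCentred x)) → ∀ w → fromCentred (g w) ≡ f (fromCentred w)
fromCentred-intertwines {f} {g} to-f w = begin
  fromCentred (g w)                             ≡⟨ cong (fromCentred ∘ g) (toCentred-fromCentred w) ⟨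
  fromCentred (g (toCentred (fromCentred w)))   ≡⟨ cong fromCentred (to-f (fromCentred w)) ⟨
  fromCentred (toCentred (f (fromCentred w)))   ≡⟨ fromCentred-toCentred _ ⟩
  f (fromCentred w)                             ∎

-- The shape of a lamp sequence read away from the lamplighter:
-- 1ⁿ0^ω, 0⁺1⁺0^ω, or anything else.
data Shape : Set where
  lit : ℕ → Shape
  darkThenLit irregular : Shape

step : Bool → Shape → Shape
step _     irregular     = irregular
step true  (lit n)       = lit (suc n)
step false (lit zero)    = lit zero
step false (lit (suc n)) = darkThenLit
step true  darkThenLit   = irregular
step false darkThenLit   = darkThenLit

shapeNE : NE → Shape
shapeNE end     = lit 1
shapeNE (b ∷ x) = step b (shapeNE x)

shape : NList → Shape
shape nothing  = lit 0
shape (just x) = shapeNE x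

shape-consN : ∀ b l → shape (consN b l) ≡ step b (shape l)
shape-consN true  nothing  = refl
shape-consN false nothing  = refl
shape-consN true  (just _) = refl
shape-consN false (just _) = refl

shape-unfold : ∀ l → shape l ≡ step (hd l) (shape (tl l))
shape-unfold l = trans (cong shape (sym (consN-hd-tl l))) (shape-consN (hd l) (tl l))

-- sheetPoint y x at position p (y lamps lit ahead, x behind) is step x of the
-- a-chain carrying the tile of ℍ in row p − x at offset x + y from the diagonal.
data Region : Set where
  sheetPoint : ℕ → ℕ → Region
  pastSheet elsewhere : Region

region : Shape → Shape → Region
region (lit y)    (lit x)     = sheetPoint y x
region (lit zero) darkThenLit = pastSheet
region _          _           = elsewhere

-- θ n k is the tile at (n + k , n).
ValidOffsets : {c : ℕ} → List (HTile c) → (ℤ → ℕ → HTile c) → Set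
ValidOffsets T θ =
  (∀ n k → θ n k ∈ T) ×
  (∀ n k → north (θ n (suc k)) ≡ south (θ (n + 1ℤ) k)) ×
  (∀ n k → east (θ n k) ≡ west (θ n (suc k)))

toOffsets : ∀ {c} → (ℤ → ℤ → HTile c) → ℤ → ℕ → HTile c
toOffsets ζ n k = ζ (n + + k) n

fromOffsets : ∀ {c} → (ℤ → ℕ → HTile c) → ℤ → ℤ → HTile c
fromOffsets θ m n = θ n ∣ m - n ∣

offsets-of-ValidH : ∀ {c} {T : List (HTile c)} {ζ} → ValidH T ζ → ValidOffsets T (toOffsets ζ)
offsets-of-ValidH {ζ = ζ} (∈T , north≡south , east≡west) =
  (λ n k → ∈T _ _ (ℤP.i≤i+j n (+ k))) , north′ , east′
  where
  north′ : ∀ n k → north (ζ (n + + suc k) n) ≡ south (ζ ((n + 1ℤ) + + k) (n + 1ℤ))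
  north′ n k = begin
    north (ζ (n + + suc k) n)
      ≡⟨ cong₂ (λ m n′ → north (ζ m n′)) (i+1+j≡i+[1+j] n (+ k)) (i+1-1≡i n) ⟨
    north (ζ ((n + 1ℤ) + + k) ((n + 1ℤ) - 1ℤ))
      ≡⟨ north≡south _ _ (ℤP.i≤i+j (n + 1ℤ) (+ k)) ⟩
    south (ζ ((n + 1ℤ) + + k) (n + 1ℤ)) ∎
  east′ : ∀ n k → east (ζ (n + + k) n) ≡ west (ζ (n + + suc k) n)
  east′ n k = trans (east≡west _ _ (ℤP.i≤i+j n (+ k)))
                    (cong (λ m → west (ζ m n)) (i+j+1≡i+[1+j] n (+ k)))

ValidH-of-offsets : ∀ {c} {T : List (HTile c)} {θ} → ValidOffsets T θ → ValidH T (fromOffsets θ)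
ValidH-of-offsets {θ = θ} (∈T , north≡south , east≡west) =
  (λ _ _ _ → ∈T _ _) , north′ , east′
  where
  north′ : ∀ m n → n ≤ m →
           north (θ (n - 1ℤ) ∣ m - (n - 1ℤ) ∣) ≡ south (θ n ∣ m - n ∣)
  north′ m n n≤m = begin
    north (θ (n - 1ℤ) ∣ m - (n - 1ℤ) ∣)
      ≡⟨ cong (λ i → north (θ (n - 1ℤ) ∣ i ∣)) (i-[j-1]≡1+[i-j] m n) ⟩
    north (θ (n - 1ℤ) ∣ 1ℤ + (m - n) ∣)
      ≡⟨ cong (λ k → north (θ (n - 1ℤ) k)) (∣1+i∣≡1+∣i∣ (ℤP.i≤j⇒0≤j-i n≤m)) ⟩
    north (θ (n - 1ℤ) (suc ∣ m - n ∣))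
      ≡⟨ north≡south _ _ ⟩
    south (θ ((n - 1ℤ) + 1ℤ) ∣ m - n ∣)
      ≡⟨ cong (λ n′ → south (θ n′ ∣ m - n ∣)) (i-1+1≡i n) ⟩
    south (θ n ∣ m - n ∣) ∎
  east′ : ∀ m n → n ≤ m → east (θ n ∣ m - n ∣) ≡ west (θ n ∣ (m + 1ℤ) - n ∣)
  east′ m n n≤m = begin
    east (θ n ∣ m - n ∣)
      ≡⟨ east≡west _ _ ⟩
    west (θ n (suc ∣ m - n ∣))
      ≡⟨ cong (λ k → west (θ n k)) (∣1+i∣≡1+∣i∣ (ℤP.i≤j⇒0≤j-i n≤m)) ⟨
    west (θ n ∣ 1ℤ + (m - n) ∣)
      ≡⟨ cong (λ i → west (θ n ∣ i ∣)) (i+1-j≡1+[i-j] m n) ⟨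
    west (θ n ∣ (m + 1ℤ) - n ∣) ∎

setOrigin : ∀ {c} → HTile c → (ℤ → ℕ → HTile c) → ℤ → ℕ → HTile c
setOrigin t θ n        (suc k) = θ n (suc k)
setOrigin t θ (+ zero) zero    = t
setOrigin t θ n        zero    = θ n zero

setOrigin-side : ∀ {c} {t : HTile c} {θ} {A : Set} (side : HTile c → A) →
                 side t ≡ side (θ 0ℤ 0) → ∀ n k → side (setOrigin t θ n k) ≡ side (θ n k)
setOrigin-side side eq n        (suc k) = refl
setOrigin-side side eq (+ zero)  zero   = eq
setOrigin-side side eq (+ suc _) zero   = refl
setOrigin-side side eq -[1+ _ ]  zero   = refl

-- The diagonal tiles θ n 0 are constrained only through their south and east sides.
setOrigin-valid : ∀ {c} {T : List (HTile c)} {θ} {t} → ValidOffsets T θ → t ∈ T →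
                  south t ≡ south (θ 0ℤ 0) → east t ≡ east (θ 0ℤ 0) →
                  ValidOffsets T (setOrigin t θ)
setOrigin-valid {T = T} {θ} {t} (∈T , north≡south , east≡west) t∈T south≡ east≡ =
  ∈T′ ,
  (λ n k → trans (north≡south n k) (sym (setOrigin-side south south≡ (n + 1ℤ) k))) ,
  (λ n k → trans (setOrigin-side east east≡ n k) (east≡west n k))
  where
  ∈T′ : ∀ n k → setOrigin t θ n k ∈ T
  ∈T′ n         (suc k) = ∈T n (suc k)
  ∈T′ (+ zero)  zero    = t∈T
  ∈T′ (+ suc _) zero    = ∈T _ _
  ∈T′ -[1+ _ ]  zero    = ∈T _ _

-- The tile set Π_T

module TileSet {c : ℕ} (T : List (HTile c)) where

  N : ℕ
  N = length T

  tile : Fin N → HTile c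
  tile = lookup T

  data Colour : Set where
    blank alongDiagonal pastLast : Colour
    carry : Fin N → Colour
    horizontal vertical : Fin c → Colour

  horizontal-injective : ∀ {e e′} → horizontal e ≡ horizontal e′ → e ≡ e′
  horizontal-injective refl = refl

  vertical-injective : ∀ {e e′} → vertical e ≡ vertical e′ → e ≡ e′
  vertical-injective refl = refl

  colours : List Colour
  colours = blank ∷ alongDiagonal ∷ pastLast ∷
            map carry (allFin N) ++ map horizontal (allFin c) ++ map vertical (allFin c)

  ∈-colours : ∀ x → x ∈ colours
  ∈-colours blank          = here refl
  ∈-colours alongDiagonal  = there (here refl)
  ∈-colours pastLast       = there (there (here refl))
  ∈-colours (carry i)      = there (there (there (∈-++⁺ˡ (∈-map⁺ carry (∈-allFin i)))))
  ∈-colours (horizontal e) =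
    there (there (there (∈-++⁺ʳ (map carry (allFin N))
      (∈-++⁺ˡ (∈-map⁺ horizontal (∈-allFin e))))))
  ∈-colours (vertical e)   =
    there (there (there (∈-++⁺ʳ (map carry (allFin N))
      (∈-++⁺ʳ (map horizontal (allFin c)) (∈-map⁺ vertical (∈-allFin e))))))

  d : ℕ
  d = length colours

  encode : Colour → Fin d
  encode x = Any.index (∈-colours x)

  encode-injective : ∀ {x y} → encode x ≡ encode y → x ≡ y
  encode-injective {x} {y} eq =
    trans (lookup-index (∈-colours x))
          (trans (cong (lookup colours) eq) (sym (lookup-index (∈-colours y))))

  data Tag : Set where
    away past : Tag
    diagonal : HTile c → Tag
    first inner last : Fin N → Tag

  colA colA⁻¹ colB colB⁻¹ : Tag → Colour
  colA away         = blank
  colA past         = pastLast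
  colA (diagonal _) = alongDiagonal
  colA (first i)    = carry i
  colA (inner i)    = carry i
  colA (last _)     = pastLast

  colA⁻¹ away         = blank
  colA⁻¹ past         = pastLast
  colA⁻¹ (diagonal _) = alongDiagonal
  colA⁻¹ (first _)    = blank
  colA⁻¹ (inner i)    = carry i
  colA⁻¹ (last i)     = carry i

  colB (diagonal t) = horizontal (east t)
  colB (first i)    = vertical (north (tile i))
  colB (last i)     = horizontal (east (tile i))
  colB _            = blank

  colB⁻¹ (diagonal t) = vertical (south t)
  colB⁻¹ (first i)    = vertical (south (tile i))
  colB⁻¹ (last i)     = horizontal (west (tile i))
  colB⁻¹ _            = blank

  render : Tag → LTile d
  render τ = ltile (encode (colA τ)) (encode (colB τ)) (encode (colA⁻¹ τ)) (encode (colB⁻¹ τ))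

  Admissible : Tag → Set
  Admissible (diagonal t) = t ∈ T
  Admissible _            = ⊤

  tags : List Tag
  tags = away ∷ past ∷
         map diagonal T ++ map first (allFin N) ++ map inner (allFin N) ++ map last (allFin N)

  ∈-tags : ∀ τ → Admissible τ → τ ∈ tags
  ∈-tags away         _   = here refl
  ∈-tags past         _   = there (here refl)
  ∈-tags (diagonal t) t∈T = there (there (∈-++⁺ˡ (∈-map⁺ diagonal t∈T)))
  ∈-tags (first i)    _   = there (there (∈-++⁺ʳ (map diagonal T)
                              (∈-++⁺ˡ (∈-map⁺ first (∈-allFin i)))))
  ∈-tags (inner i)    _   = there (there (∈-++⁺ʳ (map diagonal T) (∈-++⁺ʳ (map first (allFin N))
                              (∈-++⁺ˡ (∈-map⁺ inner (∈-allFin i))))))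
  ∈-tags (last i)     _   = there (there (∈-++⁺ʳ (map diagonal T) (∈-++⁺ʳ (map first (allFin N))
                              (∈-++⁺ʳ (map inner (allFin N)) (∈-map⁺ last (∈-allFin i))))))

  tags-admissible : All.All Admissible tags
  tags-admissible =
    tt All.∷ tt All.∷ ++⁺ (map⁺ (All.tabulate (λ t∈T → t∈T)))
      (++⁺ (map⁺ {f = first} (All.universal (λ _ → tt) (allFin N)))
        (++⁺ (map⁺ {f = inner} (All.universal (λ _ → tt) (allFin N)))
          (map⁺ {f = last} (All.universal (λ _ → tt) (allFin N)))))

  Π : List (LTile d)
  Π = map render tags

  seed : HTile c → LTile d
  seed t₀ = render (diagonal t₀)

  seed∈Π : ∀ {t₀} → t₀ ∈ T → seed t₀ ∈ Π
  seed∈Π {t₀} t₀∈T = ∈-map⁺ render (∈-tags (diagonal t₀) t₀∈T)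

  sheetTag : ℕ → ℕ → Fin N → Tag
  sheetTag zero    zero    i = diagonal (tile i)
  sheetTag (suc _) zero    i = first i
  sheetTag zero    (suc _) i = last i
  sheetTag (suc _) (suc _) i = inner i

  colA-sheetTag : ∀ y x i → colA (sheetTag (suc y) x i) ≡ carry i
  colA-sheetTag y zero    i = refl
  colA-sheetTag y (suc x) i = refl

  colA⁻¹-sheetTag : ∀ y x i → colA⁻¹ (sheetTag y (suc x) i) ≡ carry i
  colA⁻¹-sheetTag zero    x i = refl
  colA⁻¹-sheetTag (suc y) x i = refl

  colB-sheetTag : ∀ x i → colB (sheetTag zero x i) ≡ horizontal (east (tile i))
  colB-sheetTag zero    i = refl
  colB-sheetTag (suc x) i = refl

  colB⁻¹-sheetTag : ∀ y i → colB⁻¹ (sheetTag y zero i) ≡ vertical (south (tile i))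
  colB⁻¹-sheetTag zero    i = refl
  colB⁻¹-sheetTag (suc y) i = refl

  diagonal-by-colA : ∀ τ → colA τ ≡ alongDiagonal → ∃ λ t → τ ≡ diagonal t
  diagonal-by-colA (diagonal t) _ = t , refl
  diagonal-by-colA away         ()
  diagonal-by-colA past         ()
  diagonal-by-colA (first _)    ()
  diagonal-by-colA (inner _)    ()
  diagonal-by-colA (last _)     ()

  diagonal-by-colA⁻¹ : ∀ τ → colA⁻¹ τ ≡ alongDiagonal → ∃ λ t → τ ≡ diagonal t
  diagonal-by-colA⁻¹ (diagonal t) _ = t , refl
  diagonal-by-colA⁻¹ away         ()
  diagonal-by-colA⁻¹ past         ()
  diagonal-by-colA⁻¹ (first _)    ()
  diagonal-by-colA⁻¹ (inner _)    ()
  diagonal-by-colA⁻¹ (last _)     ()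

  inner-or-last-by-colA⁻¹ : ∀ τ {i} → colA⁻¹ τ ≡ carry i → τ ≡ inner i ⊎ τ ≡ last i
  inner-or-last-by-colA⁻¹ (inner _)    refl = inj₁ refl
  inner-or-last-by-colA⁻¹ (last _)     refl = inj₂ refl
  inner-or-last-by-colA⁻¹ away         ()
  inner-or-last-by-colA⁻¹ past         ()
  inner-or-last-by-colA⁻¹ (diagonal _) ()
  inner-or-last-by-colA⁻¹ (first _)    ()

  past-by-colA⁻¹ : ∀ τ → colA⁻¹ τ ≡ pastLast → τ ≡ past
  past-by-colA⁻¹ past         _ = refl
  past-by-colA⁻¹ away         ()
  past-by-colA⁻¹ (diagonal _) ()
  past-by-colA⁻¹ (first _)    ()
  past-by-colA⁻¹ (inner _)    ()
  past-by-colA⁻¹ (last _)     ()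

  first-by-colB : ∀ τ {e} → colB τ ≡ vertical e → ∃ λ i → τ ≡ first i
  first-by-colB (first i)    _ = i , refl
  first-by-colB away         ()
  first-by-colB past         ()
  first-by-colB (diagonal _) ()
  first-by-colB (inner _)    ()
  first-by-colB (last _)     ()

  last-by-colB⁻¹ : ∀ τ {e} → colB⁻¹ τ ≡ horizontal e → ∃ λ i → τ ≡ last i
  last-by-colB⁻¹ (last i)     _ = i , refl
  last-by-colB⁻¹ away         ()
  last-by-colB⁻¹ past         ()
  last-by-colB⁻¹ (diagonal _) ()
  last-by-colB⁻¹ (first _)    ()
  last-by-colB⁻¹ (inner _)    ()

reduction : Reduction
reduction c T t₀ = d , Π , seed t₀
  where open TileSet T

-- From a tiling of ℍ to a tiling of L

module FromHalfPlane {c : ℕ} {T : List (HTile c)} {θ : ℤ → ℕ → HTile c}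
                     (valid : ValidOffsets T θ) where
  open TileSet T

  index : ℤ → ℕ → Fin N
  index n k = Any.index (proj₁ valid n k)

  tile-index : ∀ n k → tile (index n k) ≡ θ n k
  tile-index n k = sym (lookup-index (proj₁ valid n k))

  regionTag : Region → ℤ → Tag
  regionTag (sheetPoint y x) p = sheetTag y x (index (p - + x) (x ℕ.+ y))
  regionTag pastSheet        _ = past
  regionTag elsewhere        _ = away

  regionTag-admissible : ∀ r p → Admissible (regionTag r p)
  regionTag-admissible (sheetPoint zero    zero)    p = ∈-lookup _
  regionTag-admissible (sheetPoint (suc _) zero)    p = tt
  regionTag-admissible (sheetPoint zero    (suc _)) p = tt
  regionTag-admissible (sheetPoint (suc _) (suc _)) p = tt
  regionTag-admissible pastSheet                    p = tt
  regionTag-admissible elsewhere                    p = tt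

  -- Along an a- or b-edge the lamp b at the lamplighter passes from ahead to behind
  -- (toggled for b); s and s′ are the shapes of the other lamps ahead and behind.
  a-link-by-shape : ∀ s b s′ p → colA (regionTag (region (step b s) s′) p) ≡
                                  colA⁻¹ (regionTag (region s (step b s′)) (p + 1ℤ))
  a-link-by-shape (lit y) true (lit x) p = begin
    colA (sheetTag (suc y) x (index (p - + x) (x ℕ.+ suc y)))
      ≡⟨ colA-sheetTag y x _ ⟩
    carry (index (p - + x) (x ℕ.+ suc y))
      ≡⟨ cong₂ (λ n k → carry (index n k)) (i+1-[1+j]≡i-j p (+ x)) (sym (ℕP.+-suc x y)) ⟨
    carry (index ((p + 1ℤ) - + suc x) (suc x ℕ.+ y))
      ≡⟨ colA⁻¹-sheetTag y x _ ⟨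
    colA⁻¹ (sheetTag y (suc x) (index ((p + 1ℤ) - + suc x) (suc x ℕ.+ y))) ∎
  a-link-by-shape (lit zero)    false (lit zero)    p = refl
  a-link-by-shape (lit zero)    false (lit (suc x)) p = refl
  a-link-by-shape (lit (suc y)) false (lit zero)    p = refl
  a-link-by-shape (lit (suc y)) false (lit (suc x)) p = refl
  a-link-by-shape (lit y)       true  darkThenLit   p = refl
  a-link-by-shape (lit zero)    false darkThenLit   p = refl
  a-link-by-shape (lit (suc y)) false darkThenLit   p = refl
  a-link-by-shape (lit y)       true  irregular     p = refl
  a-link-by-shape (lit zero)    false irregular     p = refl
  a-link-by-shape (lit (suc y)) false irregular     p = refl
  a-link-by-shape darkThenLit   true  s′            p = refl
  a-link-by-shape darkThenLit   false s′            p = refl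
  a-link-by-shape irregular     b     s′            p = refl

  index-north : ∀ n k → north (tile (index n (suc k))) ≡ south (tile (index (n + 1ℤ) k))
  index-north n k = begin
    north (tile (index n (suc k)))     ≡⟨ cong north (tile-index n (suc k)) ⟩
    north (θ n (suc k))                ≡⟨ proj₁ (proj₂ valid) n k ⟩
    south (θ (n + 1ℤ) k)               ≡⟨ cong south (tile-index (n + 1ℤ) k) ⟨
    south (tile (index (n + 1ℤ) k))    ∎

  index-east : ∀ n k → east (tile (index n k)) ≡ west (tile (index n (suc k)))
  index-east n k = begin
    east (tile (index n k))         ≡⟨ cong east (tile-index n k) ⟩
    east (θ n k)                    ≡⟨ proj₂ (proj₂ valid) n k ⟩
    west (θ n (suc k))              ≡⟨ cong west (tile-index n (suc k)) ⟨
    west (tile (index n (suc k)))   ∎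

  b-link-by-shape : ∀ s b s′ p → colB (regionTag (region (step b s) s′) p) ≡
                                  colB⁻¹ (regionTag (region s (step (not b) s′)) (p + 1ℤ))
  b-link-by-shape (lit y) true (lit zero) p = begin
    vertical (north (tile (index (p - + 0) (suc y))))
      ≡⟨ cong vertical (index-north _ y) ⟩
    vertical (south (tile (index ((p - + 0) + 1ℤ) y)))
      ≡⟨ cong (λ n → vertical (south (tile (index n y)))) (i-0+1≡i+1-0 p) ⟩
    vertical (south (tile (index ((p + 1ℤ) - + 0) y)))
      ≡⟨ colB⁻¹-sheetTag y _ ⟨
    colB⁻¹ (sheetTag y zero (index ((p + 1ℤ) - + 0) y)) ∎
  b-link-by-shape (lit zero) false (lit x) p = begin
    colB (sheetTag zero x (index (p - + x) (x ℕ.+ 0)))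
      ≡⟨ colB-sheetTag x _ ⟩
    horizontal (east (tile (index (p - + x) (x ℕ.+ 0))))
      ≡⟨ cong horizontal (index-east _ _) ⟩
    horizontal (west (tile (index (p - + x) (suc x ℕ.+ 0))))
      ≡⟨ cong (λ n → horizontal (west (tile (index n (suc x ℕ.+ 0))))) (i+1-[1+j]≡i-j p (+ x)) ⟨
    horizontal (west (tile (index ((p + 1ℤ) - + suc x) (suc x ℕ.+ 0)))) ∎
  b-link-by-shape (lit zero)    true  (lit (suc x)) p = refl
  b-link-by-shape (lit (suc y)) true  (lit (suc x)) p = refl
  b-link-by-shape (lit (suc y)) false (lit x)       p = refl
  b-link-by-shape (lit zero)    true  darkThenLit   p = refl
  b-link-by-shape (lit (suc y)) true  darkThenLit   p = refl
  b-link-by-shape (lit zero)    false darkThenLit   p = refl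
  b-link-by-shape (lit (suc y)) false darkThenLit   p = refl
  b-link-by-shape (lit y)       true  irregular     p = refl
  b-link-by-shape (lit zero)    false irregular     p = refl
  b-link-by-shape (lit (suc y)) false irregular     p = refl
  b-link-by-shape darkThenLit   true  s′            p = refl
  b-link-by-shape darkThenLit   false s′            p = refl
  b-link-by-shape irregular     b     s′            p = refl

  tagAt : Centred → Tag
  tagAt ((r , l) , p) = regionTag (region (shape r) (shape l)) p

  tagAt-admissible : ∀ w → Admissible (tagAt w)
  tagAt-admissible ((r , l) , p) = regionTag-admissible (region (shape r) (shape l)) p

  a-link : ∀ w → colA (tagAt w) ≡ colA⁻¹ (tagAt (moveA w))
  a-link ((r , l) , p) rewrite shape-unfold r | shape-consN (hd r) l =
    a-link-by-shape (shape (tl r)) (hd r) (shape l) p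

  b-link : ∀ w → colB (tagAt w) ≡ colB⁻¹ (tagAt (moveB w))
  b-link ((r , l) , p) rewrite shape-unfold r | shape-consN (not (hd r)) l =
    b-link-by-shape (shape (tl r)) (hd r) (shape l) p

  η : L → LTile d
  η g = render (tagAt (toCentred g))

  η-valid : ValidL Π η
  η-valid =
    (λ g → ∈-map⁺ render (∈-tags _ (tagAt-admissible (toCentred g)))) ,
    (λ g → cong encode (trans (a-link (toCentred g))
                              (cong (colA⁻¹ ∘ tagAt) (sym (toCentred-·a g))))) ,
    (λ g → cong encode (trans (b-link (toCentred g))
                              (cong (colB⁻¹ ∘ tagAt) (sym (toCentred-·b g)))))

  η-one : η one ≡ seed (θ 0ℤ 0)
  η-one = cong seed (tile-index 0ℤ 0)

-- From a tiling of L to a tiling of ℍ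

fromCentred-moveA : ∀ w → fromCentred (moveA w) ≡ fromCentred w ·a
fromCentred-moveA = fromCentred-intertwines toCentred-·a

fromCentred-moveB : ∀ w → fromCentred (moveB w) ≡ fromCentred w ·b
fromCentred-moveB = fromCentred-intertwines toCentred-·b

sheet : ℕ → ℕ → ℤ → Centred
sheet y x p = ((ones y , ones x) , p)

moveA-sheet : ∀ y x p → moveA (sheet (suc y) x p) ≡ sheet y (suc x) (p + 1ℤ)
moveA-sheet y x p = cong (_, p + 1ℤ) (stepA-consN true (ones y) (ones x))

moveB-sheet : ∀ y p → moveB (sheet (suc y) 0 p) ≡ sheet y 0 (p + 1ℤ)
moveB-sheet y p = cong (_, p + 1ℤ) (stepB-consN true (ones y) nothing)

walk : ∀ j y x p → iterate moveA (sheet (y ℕ.+ j) x p) j ≡ sheet y (x ℕ.+ j) (p + + j)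
walk zero y x p
  rewrite ℕP.+-identityʳ y | ℕP.+-identityʳ x | ℤP.+-identityʳ p = refl
walk (suc j) y x p = begin
  iterate moveA (moveA (sheet (y ℕ.+ suc j) x p)) j
    ≡⟨ cong (λ z → iterate moveA (moveA (sheet z x p)) j) (ℕP.+-suc y j) ⟩
  iterate moveA (moveA (sheet (suc (y ℕ.+ j)) x p)) j
    ≡⟨ cong (λ w → iterate moveA w j) (moveA-sheet (y ℕ.+ j) x p) ⟩
  iterate moveA (sheet (y ℕ.+ j) (suc x) (p + 1ℤ)) j
    ≡⟨ walk j y (suc x) (p + 1ℤ) ⟩
  sheet y (suc x ℕ.+ j) ((p + 1ℤ) + + j)
    ≡⟨ cong₂ (sheet y) (sym (ℕP.+-suc x j)) (i+1+j≡i+[1+j] p (+ j)) ⟩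
  sheet y (x ℕ.+ suc j) (p + + suc j) ∎

module ToHalfPlane {c : ℕ} (T : List (HTile c)) (t₀ : HTile c) {η : L → LTile (TileSet.d T)}
                   (valid : ValidL (TileSet.Π T) η) (origin : η one ≡ TileSet.seed T t₀) where
  open TileSet T

  private
    tagAt-spec : ∀ w → ∃ λ τ → τ ∈ tags × η (fromCentred w) ≡ render τ
    tagAt-spec w = ∈-map⁻ render (proj₁ valid (fromCentred w))

  tagAt : Centred → Tag
  tagAt w = proj₁ (tagAt-spec w)

  tagAt-admissible : ∀ w → Admissible (tagAt w)
  tagAt-admissible w = All.lookup tags-admissible (proj₁ (proj₂ (tagAt-spec w)))

  η-tagAt : ∀ w → η (fromCentred w) ≡ render (tagAt w)
  η-tagAt w = proj₂ (proj₂ (tagAt-spec w))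

  a-link : ∀ w → colA (tagAt w) ≡ colA⁻¹ (tagAt (moveA w))
  a-link w = encode-injective (begin
    encode (colA (tagAt w))              ≡⟨ cong col-a (η-tagAt w) ⟨
    col-a (η (fromCentred w))            ≡⟨ proj₁ (proj₂ valid) (fromCentred w) ⟩
    col-a⁻¹ (η (fromCentred w ·a))       ≡⟨ cong (col-a⁻¹ ∘ η) (fromCentred-moveA w) ⟨
    col-a⁻¹ (η (fromCentred (moveA w)))  ≡⟨ cong col-a⁻¹ (η-tagAt (moveA w)) ⟩
    encode (colA⁻¹ (tagAt (moveA w)))    ∎)

  b-link : ∀ w → colB (tagAt w) ≡ colB⁻¹ (tagAt (moveB w))
  b-link w = encode-injective (begin
    encode (colB (tagAt w))              ≡⟨ cong col-b (η-tagAt w) ⟨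
    col-b (η (fromCentred w))            ≡⟨ proj₂ (proj₂ valid) (fromCentred w) ⟩
    col-b⁻¹ (η (fromCentred w ·b))       ≡⟨ cong (col-b⁻¹ ∘ η) (fromCentred-moveB w) ⟨
    col-b⁻¹ (η (fromCentred (moveB w)))  ≡⟨ cong col-b⁻¹ (η-tagAt (moveB w)) ⟩
    encode (colB⁻¹ (tagAt (moveB w)))    ∎)

  tagAt-origin : render (tagAt (sheet 0 0 0ℤ)) ≡ seed t₀
  tagAt-origin = trans (sym (η-tagAt (sheet 0 0 0ℤ))) origin

  diagonal-at : ∀ p → ∃ λ t → tagAt (sheet 0 0 p) ≡ diagonal t
  diagonal-at = ℤ-induction DiagonalAt base up down
    where
    DiagonalAt : ℤ → Set
    DiagonalAt p = ∃ λ t → tagAt (sheet 0 0 p) ≡ diagonal t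
    base : DiagonalAt 0ℤ
    base = diagonal-by-colA _ (encode-injective (cong col-a tagAt-origin))
    up : ∀ p → DiagonalAt p → DiagonalAt (p + 1ℤ)
    up p (_ , eq) = diagonal-by-colA⁻¹ _ (trans (sym (a-link (sheet 0 0 p))) (cong colA eq))
    down : ∀ p → DiagonalAt (p + 1ℤ) → DiagonalAt p
    down p (_ , eq) = diagonal-by-colA _ (trans (a-link (sheet 0 0 p)) (cong colA⁻¹ eq))

  mutual
    first-at : ∀ y p → ∃ λ i → tagAt (sheet (suc y) 0 p) ≡ first i
    first-at y p = first-by-colB _ (begin
      colB (tagAt (sheet (suc y) 0 p))            ≡⟨ b-link (sheet (suc y) 0 p) ⟩
      colB⁻¹ (tagAt (moveB (sheet (suc y) 0 p)))  ≡⟨ cong (colB⁻¹ ∘ tagAt) (moveB-sheet y p) ⟩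
      colB⁻¹ (tagAt (sheet y 0 (p + 1ℤ)))         ≡⟨ proj₂ (vertical-at y (p + 1ℤ)) ⟩
      vertical (proj₁ (vertical-at y (p + 1ℤ)))   ∎)

    vertical-at : ∀ y p → ∃ λ e → colB⁻¹ (tagAt (sheet y 0 p)) ≡ vertical e
    vertical-at zero    p = let t , eq = diagonal-at p in south t , cong colB⁻¹ eq
    vertical-at (suc y) p = let i , eq = first-at y p in south (tile i) , cong colB⁻¹ eq

  mutual
    last-at : ∀ x p → ∃ λ i → tagAt (sheet 0 (suc x) p) ≡ last i
    last-at x p = subst (λ q → ∃ λ i → tagAt (sheet 0 (suc x) q) ≡ last i) (i-1+1≡i p)
      (last-by-colB⁻¹ _ (trans (sym (b-link (sheet 0 x (p - 1ℤ))))
                               (proj₂ (horizontal-at x (p - 1ℤ)))))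

    horizontal-at : ∀ x p → ∃ λ e → colB (tagAt (sheet 0 x p)) ≡ horizontal e
    horizontal-at zero    p = let t , eq = diagonal-at p in east t , cong colB eq
    horizontal-at (suc x) p = let i , eq = last-at x p in east (tile i) , cong colB eq

  past-persists : ∀ w → colA (tagAt w) ≡ pastLast →
                  ∀ k → tagAt (iterate moveA (moveA w) k) ≡ past
  past-persists w eq zero    = past-by-colA⁻¹ _ (trans (sym (a-link w)) eq)
  past-persists w eq (suc k) = past-persists (moveA w) (cong colA (past-persists w eq zero)) k

  -- A last tile reached before the end of the chain would leave pastLast to
  -- propagate to its end, which is itself a last tile.
  carry-arrives : ∀ k w {i i′} → colA (tagAt w) ≡ carry i →
                  tagAt (iterate moveA w (suc k)) ≡ last i′ → i′ ≡ i
  carry-arrives k w carry≡ end≡ with inner-or-last-by-colA⁻¹ _ (trans (sym (a-link w)) carry≡)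
  carry-arrives zero w _ end≡ | inj₁ inner≡ with trans (sym inner≡) end≡
  ... | ()
  carry-arrives zero w _ end≡ | inj₂ last≡ with trans (sym end≡) last≡
  ... | refl = refl
  carry-arrives (suc k) w _ end≡ | inj₁ inner≡ = carry-arrives k (moveA w) (cong colA inner≡) end≡
  carry-arrives (suc k) w _ end≡ | inj₂ last≡
    with trans (sym (past-persists (moveA w) (cong colA last≡) k)) end≡
  ... | ()

  chain-end : ∀ k n → tagAt (sheet 0 (suc k) (n + + suc k)) ≡ last (proj₁ (first-at k n))
  chain-end k n with last-at k (n + + suc k)
  ... | i , last≡ = trans last≡ (cong last
    (carry-arrives k (sheet (suc k) 0 n) (cong colA (proj₂ (first-at k n)))
      (trans (cong tagAt (walk (suc k) 0 0 n)) last≡)))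

  θ : ℤ → ℕ → HTile c
  θ n zero    = proj₁ (diagonal-at n)
  θ n (suc k) = tile (proj₁ (first-at k n))

  south-facing : ∀ k n → colB⁻¹ (tagAt (sheet k 0 n)) ≡ vertical (south (θ n k))
  south-facing zero    n = cong colB⁻¹ (proj₂ (diagonal-at n))
  south-facing (suc k) n = cong colB⁻¹ (proj₂ (first-at k n))

  north-facing : ∀ k n → colB (tagAt (sheet (suc k) 0 n)) ≡ vertical (north (θ n (suc k)))
  north-facing k n = cong colB (proj₂ (first-at k n))

  east-facing : ∀ k n → colB (tagAt (sheet 0 k (n + + k))) ≡ horizontal (east (θ n k))
  east-facing zero    n rewrite ℤP.+-identityʳ n = cong colB (proj₂ (diagonal-at n))
  east-facing (suc k) n = cong colB (chain-end k n)

  west-facing : ∀ k n →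
                colB⁻¹ (tagAt (sheet 0 (suc k) (n + + suc k))) ≡ horizontal (west (θ n (suc k)))
  west-facing k n = cong colB⁻¹ (chain-end k n)

  θ-valid : ValidOffsets T θ
  θ-valid = θ∈T , north≡south , east≡west
    where
    θ∈T : ∀ n k → θ n k ∈ T
    θ∈T n zero    = subst Admissible (proj₂ (diagonal-at n)) (tagAt-admissible (sheet 0 0 n))
    θ∈T n (suc k) = ∈-lookup _
    north≡south : ∀ n k → north (θ n (suc k)) ≡ south (θ (n + 1ℤ) k)
    north≡south n k = vertical-injective (begin
      vertical (north (θ n (suc k)))              ≡⟨ north-facing k n ⟨
      colB (tagAt (sheet (suc k) 0 n))            ≡⟨ b-link (sheet (suc k) 0 n) ⟩
      colB⁻¹ (tagAt (moveB (sheet (suc k) 0 n)))  ≡⟨ cong (colB⁻¹ ∘ tagAt) (moveB-sheet k n) ⟩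
      colB⁻¹ (tagAt (sheet k 0 (n + 1ℤ)))         ≡⟨ south-facing k (n + 1ℤ) ⟩
      vertical (south (θ (n + 1ℤ) k))             ∎)
    east≡west : ∀ n k → east (θ n k) ≡ west (θ n (suc k))
    east≡west n k = horizontal-injective (begin
      horizontal (east (θ n k))
        ≡⟨ east-facing k n ⟨
      colB (tagAt (sheet 0 k (n + + k)))
        ≡⟨ b-link (sheet 0 k (n + + k)) ⟩
      colB⁻¹ (tagAt (sheet 0 (suc k) ((n + + k) + 1ℤ)))
        ≡⟨ cong (λ p → colB⁻¹ (tagAt (sheet 0 (suc k) p))) (i+j+1≡i+[1+j] n (+ k)) ⟩
      colB⁻¹ (tagAt (sheet 0 (suc k) (n + + suc k)))
        ≡⟨ west-facing k n ⟩
      horizontal (west (θ n (suc k))) ∎)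

  seed-θ : seed (θ 0ℤ 0) ≡ seed t₀
  seed-θ = trans (cong render (sym (proj₂ (diagonal-at 0ℤ)))) tagAt-origin

  origin-south : south t₀ ≡ south (θ 0ℤ 0)
  origin-south = vertical-injective (encode-injective (cong col-b⁻¹ (sym seed-θ)))

  origin-east : east t₀ ≡ east (θ 0ℤ 0)
  origin-east = horizontal-injective (encode-injective (cong col-b (sym seed-θ)))

tilesL-of-tilesH : ∀ {c} (T : List (HTile c)) t₀ →
                   TilesH T t₀ → TilesL (TileSet.Π T) (TileSet.seed T t₀)
tilesL-of-tilesH T t₀ (ζ , ζ-valid , ζ-origin) =
  η , η-valid , trans η-one (cong (TileSet.seed T) ζ-origin)
  where open FromHalfPlane (offsets-of-ValidH ζ-valid)

tilesH-of-tilesL : ∀ {c} (T : List (HTile c)) t₀ → t₀ ∈ T →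
                   TilesL (TileSet.Π T) (TileSet.seed T t₀) → TilesH T t₀
tilesH-of-tilesL T t₀ t₀∈T (η , η-valid , η-origin) =
  fromOffsets (setOrigin t₀ θ) ,
  ValidH-of-offsets (setOrigin-valid θ-valid t₀∈T origin-south origin-east) ,
  refl
  where open ToHalfPlane T t₀ η-valid η-origin

proposition5p4 : Σ Reduction λ R →
    (c : ℕ) (T : List (HTile c)) (t₀ : HTile c) → t₀ ∈ T →
      (proj₂ (proj₂ (R c T t₀)) ∈ proj₁ (proj₂ (R c T t₀)))
      × (TilesH T t₀ ⇔ TilesL (proj₁ (proj₂ (R c T t₀))) (proj₂ (proj₂ (R c T t₀))))
proposition5p4 = reduction , λ c T t₀ t₀∈T →
  TileSet.seed∈Π T t₀∈T , mk⇔ (tilesL-of-tilesH T t₀) (tilesH-of-tilesL T t₀ t₀∈T)
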